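{- Let $\Theta=(\alpha,\beta,\gamma)\in S_n\times S_n\times S_n$ and let $p\le n$ be a prime with $\mathbf{l}^\alpha_p\cdot\mathbf{l}^\beta_p>0$. Then: (a) if $\mathbf{l}^\gamma_1<p\cdot\max\{\mathbf{l}^\alpha_p,\mathbf{l}^\beta_p\}$ and $\mathbf{l}^\gamma_p=0$, then $\Delta(\Theta)=0$; (b) if $\mathbf{l}^\gamma_1=0$ and $\mathbf{l}^\gamma_p<\max\{\mathbf{l}^\alpha_p,\mathbf{l}^\beta_p\}$, then $\Delta(\Theta)=0$; (c) if $p=2$, $\mathbf{l}^\gamma_1=0$ and $\mathbf{l}^\gamma_2=1$, then $\Delta(\Theta)=0$.
   Context: Let $N=\{0,1,\dots,n-1\}$ and $S_n$ the symmetric group on $N$. A Latin square of order $n$ is an $n\times n$ array $L=(l_{i,j})$ with entries in $N$ in which each symbol occurs exactly once in each row and column. For $\Theta=(\alpha,\beta,\gamma)\in S_n^3$, $L^\Theta$ is the array with $(i,j)$ entry $\gamma^{ -1}(l_{\alpha(i),\beta(j)})$; $\Theta$ is an autotopism of $L$ if $L^\Theta=L$. $\Delta(\Theta)$ is the number of Latin squares of order $n$ having $\Theta$ as an autotopism. For $\delta\in S_n$, $\mathbf{l}^\delta_r$ is the number of cycles of length $r$ in its disjoint cycle decomposition (fixed points are cycles of length 1). -}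

module Defs where

open import Data.Nat using (ℕ; zero; suc; _/_)
import Data.Nat as ℕ
open import Data.Fin using (Fin; zero; suc)
open import Data.Fin.Properties using (all?) renaming (_≟_ to _≟ᶠ_)
open import Data.Fin.Permutation using (Permutation′; _⟨$⟩ʳ_; _⟨$⟩ˡ_)
open import Data.List using (List; []; _∷_; [_]; map; concatMap; filter; length; head; upTo; allFin)
open import Data.Maybe using (fromMaybe)
open import Data.Product using (_×_)
open import Relation.Nullary using (Dec)
open import Relation.Nullary.Decidable using (_×-dec_)
open import Relation.Binary.PropositionalEquality using (_≡_)

Array : ℕ → Set
Array n = Fin n → Fin n → Fin n

rowOcc : ∀ {n} → Array n → Fin n → Fin n → ℕ
rowOcc {n} L i s = length (filter (λ j → L i j ≟ᶠ s) (allFin n))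

colOcc : ∀ {n} → Array n → Fin n → Fin n → ℕ
colOcc {n} L j s = length (filter (λ i → L i j ≟ᶠ s) (allFin n))

IsLatin : ∀ {n} → Array n → Set
IsLatin L = (∀ i s → rowOcc L i s ≡ 1) × (∀ j s → colOcc L j s ≡ 1)

_^Θ : ∀ {n} → Array n → Permutation′ n × Permutation′ n × Permutation′ n → Array n
(L ^Θ) (α Data.Product., β Data.Product., γ) i j = γ ⟨$⟩ˡ L (α ⟨$⟩ʳ i) (β ⟨$⟩ʳ j)

IsAutotopism : ∀ {n} → Permutation′ n → Permutation′ n → Permutation′ n → Array n → Set
IsAutotopism α β γ L = ∀ i j → (L ^Θ) (α Data.Product., β Data.Product., γ) i j ≡ L i j

isLatin? : ∀ {n} (L : Array n) → Dec (IsLatin L)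
isLatin? L = all? (λ i → all? (λ s → rowOcc L i s ℕ.≟ 1))
       ×-dec all? (λ j → all? (λ s → colOcc L j s ℕ.≟ 1))

isAutotopism? : ∀ {n} α β γ (L : Array n) → Dec (IsAutotopism α β γ L)
isAutotopism? α β γ L = all? (λ i → all? (λ j → _ ≟ᶠ _))

allFuns : ∀ {A : Set} k → List A → List (Fin k → A)
allFuns zero    xs = [ (λ ()) ]
allFuns (suc k) xs =
  concatMap (λ a → map (λ f → λ { zero → a ; (suc i) → f i }) (allFuns k xs)) xs

allArrays : ∀ n → List (Array n)
allArrays n = allFuns n (allFuns n (allFin n))

Δ : ∀ {n} → Permutation′ n → Permutation′ n → Permutation′ n → ℕ
Δ {n} α β γ = length (filter (λ L → isLatin? L ×-dec isAutotopism? α β γ L) (allArrays n))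

iter : ∀ {n} → Permutation′ n → ℕ → Fin n → Fin n
iter σ zero    x = x
iter σ (suc k) x = σ ⟨$⟩ʳ iter σ k x

cycleLen : ∀ {n} → Permutation′ n → Fin n → ℕ
cycleLen {n} σ x = fromMaybe 0 (head (filter (λ k → iter σ k x ≟ᶠ x) (map suc (upTo n))))

pointsInCycles : ∀ {n} → ℕ → Permutation′ n → ℕ
pointsInCycles {n} r σ = length (filter (λ x → cycleLen σ x ℕ.≟ r) (allFin n))

-- l^σ_r : number of cycles of length r (each such cycle has exactly r points)
cycles : ∀ {n} → ℕ → Permutation′ n → ℕ
cycles zero    σ = 0
cycles (suc k) σ = pointsInCycles (suc k) σ / suc k

-- Iterating Θ gives L(αᵏ i, βᵏ j) = γᵏ (L i j).  Hence if row i lies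
-- in a p-cycle of α and column j in a p-cycle of β, then γᵖ fixes L i j, so
-- the symbol L i j lies in a γ-cycle of length 1 or p.  Fixing such a column
-- j, the map i ↦ L i j is injective, so the p · l^α_p rows lying in p-cycles
-- of α give as many distinct symbols in γ-cycles of length 1 or p.  By
-- transposing L the same holds with α and β exchanged.  Parts (a) and (b)
-- follow by counting; part (c) finds, inside a 2×2 block, four distinct
-- symbols in 2-cycles of γ, while l^γ_2 = 1 allows only two.
module Submission where

open import Defs
open import Data.Nat using (ℕ; _≤_; _<_; _*_; _⊔_)
open import Data.Nat.Primality using (Prime)
open import Data.Fin.Permutation using (Permutation′)
open import Data.Product using (_×_)
open import Relation.Binary.PropositionalEquality using (_≡_)

open import Data.Nat using (zero; suc; _+_; _∸_; z≤n; s≤s; _/_; _%_; NonZero; ≢-nonZero⁻¹; >-nonZero; >-nonZero⁻¹)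
  renaming (_≟_ to _≟ₙ_)
open import Data.Nat.Properties
open import Data.Nat.DivMod using (m≡m%n+[m/n]*n; m%n<n; n/1≡n; m/n*n≤m; m*n/n≡m; /-monoˡ-≤; m≥n⇒m/n>0; m/n≤m)
open import Data.Nat.Divisibility using (_∣_; divides)
open import Data.Nat.Primality using (prime⇒irreducible; prime⇒nonZero)
open import Data.Fin using (Fin; toℕ)
open import Data.Fin.Properties using (toℕ-injective; toℕ<n) renaming (_≟_ to _≟ᶠ_)
open import Data.Fin.Permutation using (_⟨$⟩ʳ_; _⟨$⟩ˡ_; inverseʳ; inverseˡ)
open import Data.List using (List; []; _∷_; map; filter; length; head; upTo; applyUpTo; allFin)
open import Data.List.Properties using (map-applyUpTo; length-map; length-tabulate)
open import Data.Maybe using (Maybe; just; fromMaybe)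
open import Data.List.Relation.Unary.Any using (here; there)
open import Data.List.Relation.Unary.All as All using (All; []; _∷_)
open import Data.List.Relation.Unary.All.Properties using () renaming (map⁺ to All-map⁺)
open import Data.List.Relation.Unary.AllPairs using ([]; _∷_)
open import Data.List.Relation.Unary.Unique.Propositional using (Unique)
open import Data.List.Relation.Unary.Unique.Propositional.Properties using (map⁺; filter⁺; allFin⁺)
open import Data.List.Membership.Propositional using (_∈_)
open import Data.List.Membership.Propositional.Properties using (∈-filter⁺; ∈-filter⁻; ∈-allFin)
open import Data.Product using (∃; _,_; proj₁; proj₂)
open import Data.Sum using (_⊎_; inj₁; inj₂; [_,_]′)
open import Data.Empty using (⊥; ⊥-elim)
open import Relation.Nullary using (¬_; yes; no)
open import Relation.Binary.Definitions using (tri<; tri≈; tri>)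
open import Relation.Unary using (Decidable)
open import Relation.Binary.PropositionalEquality using (refl; sym; trans; cong; cong₂; subst; subst₂; _≢_; module ≡-Reasoning)

remove : ∀ {A : Set} {x : A} (ys : List A) → x ∈ ys → List A
remove (y ∷ ys) (here _)  = ys
remove (y ∷ ys) (there p) = y ∷ remove ys p

length-remove : ∀ {A : Set} {x : A} ys (p : x ∈ ys) → length ys ≡ suc (length (remove ys p))
length-remove (y ∷ ys) (here _)  = refl
length-remove (y ∷ ys) (there p) = cong suc (length-remove ys p)

remove-keeps : ∀ {A : Set} {x z : A} ys (p : x ∈ ys) → z ∈ ys → z ≢ x → z ∈ remove ys p
remove-keeps (y ∷ ys) (here refl) (here refl) z≢x = ⊥-elim (z≢x refl)
remove-keeps (y ∷ ys) (here refl) (there q)   z≢x = q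
remove-keeps (y ∷ ys) (there p)   (here refl) z≢x = here refl
remove-keeps (y ∷ ys) (there p)   (there q)   z≢x = there (remove-keeps ys p q z≢x)

unique-⊆⇒length-≤ : ∀ {A : Set} (xs ys : List A) → Unique xs → (∀ {z} → z ∈ xs → z ∈ ys) →
                    length xs ≤ length ys
unique-⊆⇒length-≤ []       ys _           _   = z≤n
unique-⊆⇒length-≤ (x ∷ xs) ys (x∉xs ∷ u) xs⊆ys =
  subst (suc (length xs) ≤_) (sym (length-remove ys x∈ys))
    (s≤s (unique-⊆⇒length-≤ xs (remove ys x∈ys) u
      (λ z∈xs → remove-keeps ys x∈ys (xs⊆ys (there z∈xs)) (λ z≡x → All.lookup x∉xs z∈xs (sym z≡x)))))
  where x∈ys = xs⊆ys (here refl)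

witnesses-≤-count : ∀ {n} {P : Fin n → Set} (P? : Decidable P) (xs : List (Fin n)) → Unique xs → All P xs →
                    length xs ≤ length (filter P? (allFin n))
witnesses-≤-count P? xs u all-P =
  unique-⊆⇒length-≤ xs _ u (λ z∈xs → ∈-filter⁺ P? (∈-allFin _) (All.lookup all-P z∈xs))

all-map : ∀ {A B : Set} {P : B → Set} (f : A → B) xs → (∀ {a} → a ∈ xs → P (f a)) → All P (map f xs)
all-map f xs P∘f = All-map⁺ {f = f} (All.tabulate P∘f)

filter-empty : ∀ {A : Set} {P : A → Set} (P? : Decidable P) xs → (∀ x → ¬ P x) → length (filter P? xs) ≡ 0
filter-empty P? []       none = refl
filter-empty P? (x ∷ xs) none with P? x
... | yes px = ⊥-elim (none x px)
... | no  _  = filter-empty P? xs none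

filter-nonempty : ∀ {A : Set} {P : A → Set} (P? : Decidable P) xs → 0 < length (filter P? xs) → ∃ P
filter-nonempty P? (x ∷ xs) h with P? x
... | yes px = x , px
... | no  _  = filter-nonempty P? xs h

filter-cong : ∀ {A : Set} {P Q : A → Set} (P? : Decidable P) (Q? : Decidable Q) →
              (∀ x → P x → Q x) → (∀ x → Q x → P x) → ∀ xs → filter P? xs ≡ filter Q? xs
filter-cong P? Q? P⇒Q Q⇒P []       = refl
filter-cong P? Q? P⇒Q Q⇒P (x ∷ xs) with P? x | Q? x
... | yes _  | yes _  = cong (x ∷_) (filter-cong P? Q? P⇒Q Q⇒P xs)
... | no  _  | no  _  = filter-cong P? Q? P⇒Q Q⇒P xs
... | yes px | no ¬qx = ⊥-elim (¬qx (P⇒Q x px))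
... | no ¬px | yes qx = ⊥-elim (¬px (Q⇒P x qx))

range : ℕ → ℕ → List ℕ
range m zero      = []
range m (suc len) = m ∷ range (suc m) len

map-suc-upTo : ∀ n → map suc (upTo n) ≡ range 1 n
map-suc-upTo n = trans (map-applyUpTo (λ i → i) suc n) (shifted suc 1 n (λ i → refl))
  where
  shifted : ∀ (f : ℕ → ℕ) m len → (∀ i → f i ≡ m + i) → applyUpTo f len ≡ range m len
  shifted f m zero      f≡ = refl
  shifted f m (suc len) f≡ =
    cong₂ _∷_ (trans (f≡ 0) (+-identityʳ m)) (shifted (λ i → f (suc i)) (suc m) len (λ i → trans (f≡ (suc i)) (+-suc m i)))

module FirstHit {P : ℕ → Set} (P? : Decidable P) where

  first-is-least : ∀ m len d → head (filter P? (range m len)) ≡ just d →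
                   m ≤ d × P d × (∀ k → m ≤ k → k < d → ¬ P k)
  first-is-least m (suc len) d hit with P? m
  first-is-least m (suc len) d refl | yes pm = ≤-refl , pm , λ k m≤k k<m _ → <-irrefl refl (≤-<-trans m≤k k<m)
  ... | no ¬pm with first-is-least (suc m) len d hit
  ... | m<d , pd , below = <⇒≤ m<d , pd , least
    where
    least : ∀ k → m ≤ k → k < d → ¬ P k
    least k m≤k k<d pk with m ≟ₙ k
    ... | yes refl = ¬pm pk
    ... | no  m≢k  = below k (≤∧≢⇒< m≤k m≢k) k<d pk

  first-exists : ∀ m len k → m ≤ k → k < m + len → P k → ∃ λ d → head (filter P? (range m len)) ≡ just d
  first-exists m zero      k m≤k k<m+0 pk = ⊥-elim (<-irrefl refl (≤-<-trans m≤k (subst (k <_) (+-identityʳ m) k<m+0)))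
  first-exists m (suc len) k m≤k k<m+l pk with P? m
  ... | yes _ = m , refl
  ... | no ¬pm with m ≟ₙ k
  ... | yes refl = ⊥-elim (¬pm pk)
  ... | no  m≢k  = first-exists (suc m) len k (≤∧≢⇒< m≤k m≢k) (subst (k <_) (+-suc m len) k<m+l) pk

-- cycleLen reads the search result with default 0, so a positive value was found.
fromMaybe-suc : ∀ (m : Maybe ℕ) d → fromMaybe 0 m ≡ suc d → m ≡ just (suc d)
fromMaybe-suc (just x) d refl = refl

module CycleLength {n : ℕ} (σ : Permutation′ n) where

  σ-injective : ∀ {x y} → σ ⟨$⟩ʳ x ≡ σ ⟨$⟩ʳ y → x ≡ y
  σ-injective {x} {y} σx≡σy = trans (sym (inverseˡ σ)) (trans (cong (σ ⟨$⟩ˡ_) σx≡σy) (inverseˡ σ))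

  iter-+ : ∀ a b x → iter σ (a + b) x ≡ iter σ a (iter σ b x)
  iter-+ zero    b x = refl
  iter-+ (suc a) b x = cong (σ ⟨$⟩ʳ_) (iter-+ a b x)

  iter-* : ∀ q d x → iter σ d x ≡ x → iter σ (q * d) x ≡ x
  iter-* zero    d x σᵈx≡x = refl
  iter-* (suc q) d x σᵈx≡x =
    trans (iter-+ d (q * d) x) (trans (cong (iter σ d) (iter-* q d x σᵈx≡x)) σᵈx≡x)

  iter-σ : ∀ k x → iter σ k (σ ⟨$⟩ʳ x) ≡ σ ⟨$⟩ʳ iter σ k x
  iter-σ zero    x = refl
  iter-σ (suc k) x = cong (σ ⟨$⟩ʳ_) (iter-σ k x)

  iter-injective : ∀ k {x y} → iter σ k x ≡ iter σ k y → x ≡ y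
  iter-injective zero    eq = eq
  iter-injective (suc k) eq = iter-injective k (σ-injective eq)

  isPeriod? : (x : Fin n) → Decidable (λ k → iter σ k x ≡ x)
  isPeriod? x k = iter σ k x ≟ᶠ x

  cycleLen-search : ∀ x → cycleLen σ x ≡ fromMaybe 0 (head (filter (isPeriod? x) (range 1 n)))
  cycleLen-search x = cong (λ ks → fromMaybe 0 (head (filter (isPeriod? x) ks))) (map-suc-upTo n)

  cycleLen-least : ∀ x d → cycleLen σ x ≡ suc d →
                   iter σ (suc d) x ≡ x × (∀ k → 1 ≤ k → k < suc d → iter σ k x ≢ x)
  cycleLen-least x d len≡ =
    proj₂ (FirstHit.first-is-least (isPeriod? x) 1 n (suc d) (fromMaybe-suc _ d (trans (sym (cycleLen-search x)) len≡)))

  cycleLen-period : ∀ x r → cycleLen σ x ≡ r → iter σ r x ≡ x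
  cycleLen-period x zero    _     = refl
  cycleLen-period x (suc d) len≡ = proj₁ (cycleLen-least x d len≡)

  cycleLen-moved : ∀ x d → cycleLen σ x ≡ suc (suc d) → σ ⟨$⟩ʳ x ≢ x
  cycleLen-moved x d len≡ = proj₂ (cycleLen-least x (suc d) len≡) 1 ≤-refl (s≤s (s≤s z≤n))

  cycleLen-positive : ∀ x k → 1 ≤ k → k ≤ n → iter σ k x ≡ x → ∃ λ d → cycleLen σ x ≡ suc d
  cycleLen-positive x k 1≤k k≤n σᵏx≡x with FirstHit.first-exists (isPeriod? x) 1 n k 1≤k (s≤s k≤n) σᵏx≡x
  ... | e , hit with FirstHit.first-is-least (isPeriod? x) 1 n e hit
  ... | s≤s {n = d} z≤n , _ = d , trans (cycleLen-search x) (cong (fromMaybe 0) hit)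

  cycleLen-divides : ∀ x d m → cycleLen σ x ≡ suc d → iter σ m x ≡ x → suc d ∣ m
  cycleLen-divides x d m len≡ σᵐx≡x = divides (m / suc d) (trans m≡ (cong (_+ m / suc d * suc d) r≡0))
    where
    m≡ : m ≡ m % suc d + m / suc d * suc d
    m≡ = m≡m%n+[m/n]*n m (suc d)
    remainder-period : iter σ (m % suc d) x ≡ x
    remainder-period = begin
      iter σ (m % suc d) x                                 ≡⟨ cong (iter σ (m % suc d)) (iter-* (m / suc d) (suc d) x (cycleLen-period x _ len≡)) ⟨
      iter σ (m % suc d) (iter σ (m / suc d * suc d) x)    ≡⟨ iter-+ (m % suc d) _ x ⟨
      iter σ (m % suc d + m / suc d * suc d) x             ≡⟨ cong (λ t → iter σ t x) m≡ ⟨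
      iter σ m x                                           ≡⟨ σᵐx≡x ⟩
      x                                                    ∎
      where open ≡-Reasoning
    r≡0 : m % suc d ≡ 0
    r≡0 with m % suc d | m%n<n m (suc d) | remainder-period
    ... | zero  | _ | _      = refl
    ... | suc r | r<d | σʳx≡x = ⊥-elim (proj₂ (cycleLen-least x d len≡) (suc r) (s≤s z≤n) r<d σʳx≡x)

  cycleLen-prime : ∀ x p → Prime p → p ≤ n → iter σ p x ≡ x → cycleLen σ x ≡ 1 ⊎ cycleLen σ x ≡ p
  cycleLen-prime x p p-prime p≤n σᵖx≡x = subst (λ c → c ≡ 1 ⊎ c ≡ p) (sym len≡)
      (prime⇒irreducible p-prime (cycleLen-divides x d p len≡ σᵖx≡x))
    where
    positive = cycleLen-positive x p (>-nonZero⁻¹ p {{prime⇒nonZero p-prime}}) p≤n σᵖx≡x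
    d = proj₁ positive
    len≡ = proj₂ positive

  cycleLen-σ : ∀ x → cycleLen σ (σ ⟨$⟩ʳ x) ≡ cycleLen σ x
  cycleLen-σ x = trans (cycleLen-search (σ ⟨$⟩ʳ x))
    (trans (cong (λ ks → fromMaybe 0 (head ks)) (filter-cong (isPeriod? (σ ⟨$⟩ʳ x)) (isPeriod? x) to from (range 1 n)))
           (sym (cycleLen-search x)))
    where
    to : ∀ k → iter σ k (σ ⟨$⟩ʳ x) ≡ σ ⟨$⟩ʳ x → iter σ k x ≡ x
    to k h = σ-injective (trans (sym (iter-σ k x)) h)
    from : ∀ k → iter σ k x ≡ x → iter σ k (σ ⟨$⟩ʳ x) ≡ σ ⟨$⟩ʳ x
    from k h = trans (iter-σ k x) (cong (σ ⟨$⟩ʳ_) h)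

  cycleLen-iter : ∀ k x → cycleLen σ (iter σ k x) ≡ cycleLen σ x
  cycleLen-iter zero    x = refl
  cycleLen-iter (suc k) x = trans (cycleLen-σ (iter σ k x)) (cycleLen-iter k x)

  orbit-distinct : ∀ x d → cycleLen σ x ≡ suc d → ∀ i j → i < j → j < suc d → iter σ i x ≢ iter σ j x
  orbit-distinct x d len≡ i j i<j j<d σⁱx≡σʲx = proj₂ (cycleLen-least x d len≡) (j ∸ i) (m<n⇒0<n∸m i<j)
    (≤-<-trans (m∸n≤m j i) j<d)
    (sym (iter-injective i (trans σⁱx≡σʲx
      (trans (cong (λ t → iter σ t x) (sym (m+[n∸m]≡n (<⇒≤ i<j)))) (iter-+ i (j ∸ i) x)))))

  orbit-injective : ∀ x d → cycleLen σ x ≡ suc d → ∀ {a b : Fin (suc d)} →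
                    iter σ (toℕ a) x ≡ iter σ (toℕ b) x → a ≡ b
  orbit-injective x d len≡ {a} {b} eq with <-cmp (toℕ a) (toℕ b)
  ... | tri≈ _ a≡b _ = toℕ-injective a≡b
  ... | tri< a<b _ _ = ⊥-elim (orbit-distinct x d len≡ (toℕ a) (toℕ b) a<b (toℕ<n b) eq)
  ... | tri> _ _ b<a = ⊥-elim (orbit-distinct x d len≡ (toℕ b) (toℕ a) b<a (toℕ<n a) (sym eq))

  orbit-size : ∀ x r → cycleLen σ x ≡ r → r ≤ pointsInCycles r σ
  orbit-size x zero    _     = z≤n
  orbit-size x (suc d) len≡ = subst (_≤ pointsInCycles (suc d) σ) length-orbit
      (witnesses-≤-count (λ y → cycleLen σ y ≟ₙ suc d) orbit (map⁺ (orbit-injective x d len≡) (allFin⁺ _))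
        (all-map _ (allFin (suc d)) (λ {a} _ → trans (cycleLen-iter (toℕ a) x) len≡)))
    where
    orbit = map (λ a → iter σ (toℕ a) x) (allFin (suc d))
    length-orbit : length orbit ≡ suc d
    length-orbit = trans (length-map _ (allFin (suc d))) (length-tabulate (λ i → i))

open CycleLength using (cycleLen-period; cycleLen-prime; cycleLen-moved; cycleLen-σ)

cycles-points : ∀ r .{{_ : NonZero r}} {n} (σ : Permutation′ n) → cycles r σ ≡ pointsInCycles r σ / r
cycles-points zero    σ = ⊥-elim (≢-nonZero⁻¹ 0 refl)
cycles-points (suc k) σ = refl

cycles-≤-points : ∀ r .{{_ : NonZero r}} {n} (σ : Permutation′ n) → cycles r σ * r ≤ pointsInCycles r σ
cycles-≤-points r σ = subst (λ c → c * r ≤ pointsInCycles r σ) (sym (cycles-points r σ)) (m/n*n≤m _ r)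

cycles-<⇒points-< : ∀ r .{{_ : NonZero r}} {n} (σ : Permutation′ n) a → cycles r σ < a → pointsInCycles r σ < a * r
cycles-<⇒points-< r σ a cycles<a with a * r ≤? pointsInCycles r σ
... | no  ar≰points = ≰⇒> ar≰points
... | yes ar≤points = ⊥-elim (<-irrefl refl (<-≤-trans cycles<a
      (subst (_≤ cycles r σ) (m*n/n≡m a r) (subst (a * r / r ≤_) (sym (cycles-points r σ)) (/-monoˡ-≤ r ar≤points)))))

cycles-1 : ∀ {n} (σ : Permutation′ n) → cycles 1 σ ≡ pointsInCycles 1 σ
cycles-1 σ = n/1≡n _

-- A positive cycle count exhibits a point on such a cycle; a zero count (r ≠ 0)
-- rules out such points, since one point would already give r of them.
cycles-positive⇒point : ∀ r {n} (σ : Permutation′ n) → 0 < cycles r σ → ∃ λ x → cycleLen σ x ≡ r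
cycles-positive⇒point (suc k) {n} σ h =
  filter-nonempty (λ x → cycleLen σ x ≟ₙ suc k) (allFin n) (<-≤-trans h (m/n≤m (pointsInCycles (suc k) σ) (suc k)))

cycles-zero⇒no-point : ∀ r .{{_ : NonZero r}} {n} (σ : Permutation′ n) → cycles r σ ≡ 0 → ∀ x → cycleLen σ x ≢ r
cycles-zero⇒no-point r σ none x len≡ =
  <-irrefl (sym (trans (sym (cycles-points r σ)) none)) (m≥n⇒m/n>0 (CycleLength.orbit-size σ x r len≡))

transpose : ∀ {n} → Array n → Array n
transpose L i j = L j i

transpose-latin : ∀ {n} {L : Array n} → IsLatin L → IsLatin (transpose L)
transpose-latin (rows , columns) = columns , rows

transpose-autotopism : ∀ {n} {α β γ : Permutation′ n} {L : Array n} →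
                       IsAutotopism α β γ L → IsAutotopism β α γ (transpose L)
transpose-autotopism auto i j = auto j i

column-injective : ∀ {n} {L : Array n} → IsLatin L → ∀ j {i i'} → L i j ≡ L i' j → i ≡ i'
column-injective {L = L} latin j {i} {i'} eq with i ≟ᶠ i'
... | yes i≡i' = i≡i'
... | no  i≢i' = ⊥-elim (1+n≰n (subst (2 ≤_) (proj₂ latin j (L i j))
        (witnesses-≤-count (λ i₀ → L i₀ j ≟ᶠ L i j) (i ∷ i' ∷ []) ((i≢i' ∷ []) ∷ [] ∷ []) (refl ∷ sym eq ∷ []))))

row-injective : ∀ {n} {L : Array n} → IsLatin L → ∀ i {j j'} → L i j ≡ L i j' → j ≡ j'
row-injective latin = column-injective (transpose-latin latin)

Collapses : ∀ {n} → Permutation′ n → ℕ → ℕ → Set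
Collapses {n} γ p q = ∀ (x : Fin n) → cycleLen γ x ≡ 1 ⊎ cycleLen γ x ≡ p → cycleLen γ x ≡ q

module LatinAutotopism {n : ℕ} {α β γ : Permutation′ n} {L : Array n}
                       (latin : IsLatin L) (auto : IsAutotopism α β γ L) where

  autotopism-step : ∀ i j → L (α ⟨$⟩ʳ i) (β ⟨$⟩ʳ j) ≡ γ ⟨$⟩ʳ L i j
  autotopism-step i j = trans (sym (inverseʳ γ)) (cong (γ ⟨$⟩ʳ_) (auto i j))

  autotopism-iter : ∀ k i j → L (iter α k i) (iter β k j) ≡ iter γ k (L i j)
  autotopism-iter zero    i j = refl
  autotopism-iter (suc k) i j =
    trans (autotopism-step (iter α k i) (iter β k j)) (cong (γ ⟨$⟩ʳ_) (autotopism-iter k i j))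

  entry-cycleLen : ∀ p → Prime p → p ≤ n → ∀ i j → iter α p i ≡ i → iter β p j ≡ j →
                   cycleLen γ (L i j) ≡ 1 ⊎ cycleLen γ (L i j) ≡ p
  entry-cycleLen p p-prime p≤n i j αᵖi≡i βᵖj≡j = cycleLen-prime γ (L i j) p p-prime p≤n
    (trans (sym (autotopism-iter p i j)) (cong₂ L αᵖi≡i βᵖj≡j))

  -- Main counting step: along a column j in a p-cycle of β, the rows in
  -- p-cycles of α carry distinct symbols, all in γ-cycles of length 1 or p.
  column-bound : ∀ p → Prime p → p ≤ n → ∀ j → cycleLen β j ≡ p → ∀ q → Collapses γ p q →
                 pointsInCycles p α ≤ pointsInCycles q γ
  column-bound p p-prime p≤n j βj-in-p-cycle q collapses =
    subst (_≤ pointsInCycles q γ) (length-map (λ i → L i j) rows)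
      (witnesses-≤-count (λ x → cycleLen γ x ≟ₙ q) (map (λ i → L i j) rows)
        (map⁺ (column-injective latin j) (filter⁺ _ (allFin⁺ n)))
        (all-map (λ i → L i j) rows λ {i} i∈rows → collapses (L i j)
          (entry-cycleLen p p-prime p≤n i j
            (cycleLen-period α i p (proj₂ (∈-filter⁻ (λ x → cycleLen α x ≟ₙ p) {xs = allFin n} i∈rows)))
            (cycleLen-period β j p βj-in-p-cycle))))
    where
    rows = filter (λ x → cycleLen α x ≟ₙ p) (allFin n)

  rows-bound : ∀ p → Prime p → p ≤ n → 0 < cycles p β → ∀ q → Collapses γ p q →
               cycles p α * p ≤ pointsInCycles q γ
  rows-bound p p-prime p≤n β-has q collapses =
    ≤-trans (cycles-≤-points p {{prime⇒nonZero p-prime}} α)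
      (column-bound p p-prime p≤n (proj₁ β-point) (proj₂ β-point) q collapses)
    where β-point = cycles-positive⇒point p β β-has

  -- Part (c) in miniature: rows r, α r and columns c, β c in 2-cycles span a
  -- 2×2 block with entries s, t, γ t, γ s (row by row); without fixed points of
  -- γ these four symbols are distinct and lie in 2-cycles of γ.
  two-cycle-block : Prime 2 → 2 ≤ n → (∀ x → cycleLen γ x ≢ 1) → ∀ r c → cycleLen α r ≡ 2 → cycleLen β c ≡ 2 →
                    4 ≤ pointsInCycles 2 γ
  two-cycle-block two-prime 2≤n no-fixed r c r-in-2-cycle c-in-2-cycle =
    witnesses-≤-count (λ x → cycleLen γ x ≟ₙ 2) (s ∷ t ∷ L r' c' ∷ L r' c ∷ [])
      ((s≢t ∷ s≢γs ∷ s≢γt ∷ []) ∷ (t≢γs ∷ t≢γt ∷ []) ∷ (γs≢γt ∷ []) ∷ [] ∷ [])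
      (s-in ∷ t-in ∷ γs-in ∷ γt-in ∷ [])
    where
    r' = α ⟨$⟩ʳ r
    c' = β ⟨$⟩ʳ c
    s = L r c
    t = L r c'
    period-2 : ∀ (σ : Permutation′ n) x → cycleLen σ x ≡ 2 → iter σ 2 x ≡ x × iter σ 2 (σ ⟨$⟩ʳ x) ≡ σ ⟨$⟩ʳ x
    period-2 σ x in-2 = cycleLen-period σ x 2 in-2 , cycleLen-period σ (σ ⟨$⟩ʳ x) 2 (trans (cycleLen-σ σ x) in-2)
    r-period = period-2 α r r-in-2-cycle
    c-period = period-2 β c c-in-2-cycle
    in-2-cycle : ∀ i j → iter α 2 i ≡ i → iter β 2 j ≡ j → cycleLen γ (L i j) ≡ 2
    in-2-cycle i j αi βj =
      [ (λ fixed → ⊥-elim (no-fixed _ fixed)) , (λ in-2 → in-2) ]′ (entry-cycleLen 2 two-prime 2≤n i j αi βj)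
    s-in  = in-2-cycle r  c  (proj₁ r-period) (proj₁ c-period)
    t-in  = in-2-cycle r  c' (proj₁ r-period) (proj₂ c-period)
    γs-in = in-2-cycle r' c' (proj₂ r-period) (proj₂ c-period)
    γt-in = in-2-cycle r' c  (proj₂ r-period) (proj₁ c-period)
    γs≡ : L r' c' ≡ γ ⟨$⟩ʳ s
    γs≡ = autotopism-step r c
    γt≡ : L r' c ≡ γ ⟨$⟩ʳ t
    γt≡ = trans (cong (L r') (sym (proj₁ c-period))) (autotopism-step r c')
    r≢r' : r ≢ r'
    r≢r' r≡r' = cycleLen-moved α r 0 r-in-2-cycle (sym r≡r')
    c≢c' : c ≢ c'
    c≢c' c≡c' = cycleLen-moved β c 0 c-in-2-cycle (sym c≡c')
    -- Entries in a common row or column differ since L is Latin; a symbol in a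
    -- 2-cycle differs from its image under γ.
    s≢t : s ≢ t
    s≢t eq = c≢c' (row-injective latin r eq)
    s≢γs : s ≢ L r' c'
    s≢γs eq = cycleLen-moved γ s 0 s-in (sym (trans eq γs≡))
    s≢γt : s ≢ L r' c
    s≢γt eq = r≢r' (column-injective latin c eq)
    t≢γs : t ≢ L r' c'
    t≢γs eq = r≢r' (column-injective latin c' eq)
    t≢γt : t ≢ L r' c
    t≢γt eq = cycleLen-moved γ t 0 t-in (sym (trans eq γt≡))
    γs≢γt : L r' c' ≢ L r' c
    γs≢γt eq = c≢c' (sym (row-injective latin r' eq))

-- Applying the row bound to L and to its transpose bounds the larger of l^α_p, l^β_p.
max-cycles-bound : ∀ {n} {α β γ : Permutation′ n} {L : Array n} → IsLatin L → IsAutotopism α β γ L →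
                   ∀ p → Prime p → p ≤ n → 0 < cycles p α → 0 < cycles p β → ∀ q → Collapses γ p q →
                   (cycles p α ⊔ cycles p β) * p ≤ pointsInCycles q γ
max-cycles-bound {α = α} {β} {γ} {L} latin auto p p-prime p≤n α-has β-has q collapses
  with ⊔-sel (cycles p α) (cycles p β)
... | inj₁ max≡a = subst (λ m → m * p ≤ pointsInCycles q γ) (sym max≡a)
      (LatinAutotopism.rows-bound latin auto p p-prime p≤n β-has q collapses)
... | inj₂ max≡b = subst (λ m → m * p ≤ pointsInCycles q γ) (sym max≡b)
      (LatinAutotopism.rows-bound (transpose-latin latin) (transpose-autotopism {α = α} {β} {γ} {L} auto)
        p p-prime p≤n α-has q collapses)

module Parts {n : ℕ} {α β γ : Permutation′ n} {L : Array n}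
             (latin : IsLatin L) (auto : IsAutotopism α β γ L)
             (p : ℕ) (p-prime : Prime p) (p≤n : p ≤ n) (α-has : 0 < cycles p α) (β-has : 0 < cycles p β) where

  instance
    p≢0 : NonZero p
    p≢0 = prime⇒nonZero p-prime

  -- (a) Without p-cycles in γ, all those symbols are fixed points of γ.
  part-a : cycles 1 γ < p * (cycles p α ⊔ cycles p β) → cycles p γ ≡ 0 → ⊥
  part-a few-fixed no-p-cycles = <-irrefl refl (<-≤-trans few-fixed enough-fixed)
    where
    enough-fixed : p * (cycles p α ⊔ cycles p β) ≤ cycles 1 γ
    enough-fixed = subst₂ _≤_ (*-comm _ p) (sym (cycles-1 γ)) (max-cycles-bound latin auto p p-prime p≤n α-has β-has 1
      (λ x → [ (λ fixed → fixed) , (λ in-p → ⊥-elim (cycles-zero⇒no-point p γ no-p-cycles x in-p)) ]′))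

  -- (b) Without fixed points of γ, all those symbols lie in p-cycles of γ.
  part-b : cycles 1 γ ≡ 0 → cycles p γ < cycles p α ⊔ cycles p β → ⊥
  part-b no-fixed few-p-cycles = <-irrefl refl (<-≤-trans (cycles-<⇒points-< p γ _ few-p-cycles) enough-in-p-cycles)
    where
    enough-in-p-cycles : (cycles p α ⊔ cycles p β) * p ≤ pointsInCycles p γ
    enough-in-p-cycles = max-cycles-bound latin auto p p-prime p≤n α-has β-has p
      (λ x → [ (λ fixed → ⊥-elim (cycles-zero⇒no-point 1 γ no-fixed x fixed)) , (λ in-p → in-p) ]′)

  -- (c) A single 2-cycle of γ holds only 2 points, but a 2×2 block needs 4.
  part-c : p ≡ 2 → cycles 1 γ ≡ 0 → cycles 2 γ ≡ 1 → ⊥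
  part-c refl no-fixed one-2-cycle = <-irrefl refl (<-≤-trans fewer-than-4 four-points)
    where
    fewer-than-4 : pointsInCycles 2 γ < 4
    fewer-than-4 = cycles-<⇒points-< 2 γ 2 (subst (_< 2) (sym one-2-cycle) ≤-refl)
    four-points : 4 ≤ pointsInCycles 2 γ
    four-points = LatinAutotopism.two-cycle-block latin auto p-prime p≤n (cycles-zero⇒no-point 1 γ no-fixed)
      (proj₁ (cycles-positive⇒point 2 α α-has)) (proj₁ (cycles-positive⇒point 2 β β-has))
      (proj₂ (cycles-positive⇒point 2 α α-has)) (proj₂ (cycles-positive⇒point 2 β β-has))

no-square⇒Δ≡0 : ∀ {n} (α β γ : Permutation′ n) → (∀ L → IsLatin L → IsAutotopism α β γ L → ⊥) → Δ α β γ ≡ 0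
no-square⇒Δ≡0 {n} α β γ none = filter-empty _ (allArrays n) (λ L latin×auto → none L (proj₁ latin×auto) (proj₂ latin×auto))

theorem5 : (n : ℕ) (α β γ : Permutation′ n) (p : ℕ) → Prime p → p ≤ n →
           0 < cycles p α * cycles p β →
           ((cycles 1 γ < p * (cycles p α ⊔ cycles p β) → cycles p γ ≡ 0 → Δ α β γ ≡ 0)
           × (cycles 1 γ ≡ 0 → cycles p γ < cycles p α ⊔ cycles p β → Δ α β γ ≡ 0)
           × (p ≡ 2 → cycles 1 γ ≡ 0 → cycles 2 γ ≡ 1 → Δ α β γ ≡ 0))
theorem5 n α β γ p p-prime p≤n both-have =
    (λ h₁ h₂ → no-square⇒Δ≡0 α β γ λ L latin auto → Parts.part-a latin auto p p-prime p≤n α-has β-has h₁ h₂)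
  , (λ h₁ h₂ → no-square⇒Δ≡0 α β γ λ L latin auto → Parts.part-b latin auto p p-prime p≤n α-has β-has h₁ h₂)
  , (λ h₀ h₁ h₂ → no-square⇒Δ≡0 α β γ λ L latin auto → Parts.part-c latin auto p p-prime p≤n α-has β-has h₀ h₁ h₂)
  where
  α-has : 0 < cycles p α
  α-has = >-nonZero⁻¹ _ {{m*n≢0⇒m≢0 (cycles p α) {{>-nonZero both-have}}}}
  β-has : 0 < cycles p β
  β-has = >-nonZero⁻¹ _ {{m*n≢0⇒n≢0 (cycles p α) {{>-nonZero both-have}}}}
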